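{- Let $E=\{0,1,\dots,n\}$, let $M$ be a loopless matroid on $E$, and let $i\in E$. For $1\le\ell\le n$, the following identities hold in $A^1(M)$: \[\gamma_\ell=\theta_i(\gamma_{\ell-1})+\sum_{S\not\ni i,\ |S|\ge\ell}x_S,\qquad \gamma_\ell=\theta_i(\gamma_\ell)+\sum_{S\ni i,\ |S|\le\ell}x_S,\] where on the right $\gamma_{\ell-1},\gamma_\ell$ are hypersimplex classes of $M\setminus i$ and the sums range over nonempty proper subsets $S\subsetneq E$.
   Context: For a loopless matroid $N$ on a finite ground set $U$, its Chow ring $A^*(N)$ (real coefficients) is $\mathbb{R}[x_F : F \text{ a nonempty proper flat of } N]$ modulo the ideal generated by all $x_{F_1}x_{F_2}$ with $F_1,F_2$ incomparable and all $\sum_{F\ni a}x_F-\sum_{F\ni b}x_F$ for $a,b\in U$. For $S\subseteq U$, $x_S$ means the generator if $S$ is a nonempty proper flat of $N$ and $0$ otherwise. The hypersimplex classes of $N$ are $\gamma_k=\sum_{S}\left(\min(|S|,k)-\frac{k}{|U|}|S|\right)x_S\in A^1(N)$ for $1\le k\le|U|-1$ (sum over nonempty proper $S\subsetneq U$) and $\gamma_k=0$ for $k\le0$ or $k\ge|U|$. $M\setminus i$ is the deletion, a matroid on $E\setminus\{i\}$. The pullback $\theta_i:A^*(M\setminus i)\to A^*(M)$ is the ring homomorphism with $\theta_i(x_F)=x_F+x_{F\cup\{i\}}$ for nonempty proper flats $F$ of $M\setminus i$ (each term interpreted in $A^*(M)$, hence zero if not a nonempty proper flat of $M$). -}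

module Defs where

open import Data.Nat as ℕ using (ℕ; zero; suc; _≤_; _<_; _⊓_; _∸_)
open import Data.Integer using (+_)
open import Data.Bool as Bool using (Bool; true; false; if_then_else_; _∧_)
open import Data.Fin using (Fin)
open import Data.Fin.Subset using (Subset; _∈_; _∉_; _⊆_; ⁅_⁆; _∪_; _∩_; ∣_∣; ⊤; _-_; Nonempty)
open import Data.Fin.Subset.Properties using (_∈?_; _⊆?_; nonempty?)
open import Data.Fin.Properties using (all?)
open import Data.Vec using (Vec; []; _∷_)
open import Data.Vec.Properties using (≡-dec)
open import Data.List as List using (List; []; _∷_; _++_; map; foldr; filter; allFin)
open import Data.Rational as ℚ using (ℚ; 0ℚ; 1ℚ)
open import Data.Product using (_×_; ∃)
open import Relation.Nullary using (¬_; Dec; does)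
open import Relation.Nullary.Decidable using (_×-dec_; _→-dec_; ¬?)
open import Relation.Binary.PropositionalEquality using (_≡_)

-- Matroids given by a rank function, on a ground set U ⊆ Fin m.
-- (Ground set E = {0,…,n} is Fin (suc n); the deletion M∖i has
--  ground set E ∖ {i}, same rank function restricted.)

record RawMatroid (m : ℕ) : Set where
  constructor mkRaw
  field
    ground : Subset m
    rank   : Subset m → ℕ
open RawMatroid public

record IsMatroid {m : ℕ} (N : RawMatroid m) : Set where
  field
    rank-≤-card : ∀ X → X ⊆ ground N → rank N X ≤ ∣ X ∣
    rank-mono   : ∀ X Y → Y ⊆ ground N → X ⊆ Y → rank N X ≤ rank N Y
    rank-submod : ∀ X Y → X ⊆ ground N → Y ⊆ ground N →
                  rank N (X ∪ Y) ℕ.+ rank N (X ∩ Y) ≤ rank N X ℕ.+ rank N Y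

Loopless : {m : ℕ} → RawMatroid m → Set
Loopless N = ∀ e → e ∈ ground N → rank N ⁅ e ⁆ ≡ 1

_∖_ : {m : ℕ} → RawMatroid m → Fin m → RawMatroid m
N ∖ i = mkRaw (ground N - i) (rank N)

IsNPFlat : {m : ℕ} → RawMatroid m → Subset m → Set
IsNPFlat N F = F ⊆ ground N × Nonempty F × ¬ (F ≡ ground N) ×
  (∀ e → e ∈ ground N → e ∉ F → rank N F < rank N (F ∪ ⁅ e ⁆))

isNPFlat? : {m : ℕ} (N : RawMatroid m) (F : Subset m) → Dec (IsNPFlat N F)
isNPFlat? N F = (F ⊆? ground N) ×-dec nonempty? F ×-dec ¬? (≡-dec Bool._≟_ F (ground N))
  ×-dec all? (λ e → (e ∈? ground N) →-dec (¬? (e ∈? F)) →-dec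
                    (rank N F ℕ.<? rank N (F ∪ ⁅ e ⁆)))

-- Degree-one part: formal ℚ-linear combinations of subsets of Fin m.

Lin : ℕ → Set
Lin m = Subset m → ℚ

0L : {m : ℕ} → Lin m
0L _ = 0ℚ

_⊕_ : {m : ℕ} → Lin m → Lin m → Lin m
(v ⊕ w) T = v T ℚ.+ w T

_⊖_ : {m : ℕ} → Lin m → Lin m → Lin m
(v ⊖ w) T = v T ℚ.- w T

_⊙_ : {m : ℕ} → ℚ → Lin m → Lin m
(c ⊙ v) T = c ℚ.* v T

allSubsets : (m : ℕ) → List (Subset m)
allSubsets zero    = [] ∷ []
allSubsets (suc m) = map (false ∷_) (allSubsets m) ++ map (true ∷_) (allSubsets m)

ΣS : {m : ℕ} → (Subset m → Lin m) → Lin m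
ΣS {m} f = foldr (λ S acc → f S ⊕ acc) 0L (allSubsets m)

ΣE : {m : ℕ} → Subset m → (Fin m → Lin m) → Lin m
ΣE {m} U f = foldr (λ a acc → f a ⊕ acc) 0L (filter (_∈? U) (allFin m))

-- the generator x_S of A¹(N) (zero unless S is a nonempty proper flat)
x : {m : ℕ} → RawMatroid m → Subset m → Lin m
x N S T = if does (isNPFlat? N S) ∧ does (≡-dec Bool._≟_ T S) then 1ℚ else 0ℚ

rel : {m : ℕ} → RawMatroid m → Fin m → Fin m → Lin m
rel N a b = ΣS (λ F → if does (a ∈? F) then x N F else 0L)
          ⊖ ΣS (λ F → if does (b ∈? F) then x N F else 0L)

-- equality in A¹(N): the difference lies in the ℚ-span of the linear
-- relations (the quadratic generators of the ideal contribute nothing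
-- in degree one)
_≈⟨_⟩_ : {m : ℕ} → Lin m → RawMatroid m → Lin m → Set
_≈⟨_⟩_ {m} v N w = ∃ λ (c : Fin m → Fin m → ℚ) →
  ∀ T → (v ⊖ w) T ≡ ΣE (ground N) (λ a → ΣE (ground N) (λ b → c a b ⊙ rel N a b)) T

-- ℕ → ℚ and a/b (with a/0 := 0, never used in a relevant case)
ℕ→ℚ : ℕ → ℚ
ℕ→ℚ k = + k ℚ./ 1

divℕ : ℕ → ℕ → ℚ
divℕ a zero    = 0ℚ
divℕ a (suc b) = + a ℚ./ suc b

γ : {m : ℕ} → RawMatroid m → ℕ → Lin m
γ N k with ∣ ground N ∣
... | u = if does (1 ℕ.≤? k) ∧ does (k ℕ.≤? u ∸ 1)
          then ΣS (λ S → (ℕ→ℚ (∣ S ∣ ⊓ k) ℚ.- divℕ (k ℕ.* ∣ S ∣) u) ⊙ x N S)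
          else 0L

θ : {m : ℕ} → RawMatroid m → Fin m → Lin m → Lin m
θ M i v = ΣS (λ F → v F ⊙ (if does (isNPFlat? (M ∖ i) F)
                             then x M F ⊕ x M (F ∪ ⁅ i ⁆) else 0L))

-- Both sides are degree-one classes, so it suffices to compare, for every subset T, the
-- coefficients of x_T. The pullback sends x_F to x_F + x_{F ∪ i}, hence the coefficient of x_T
-- in θ_i(γ_k(M∖i)) is that of x_{T∖i} in γ_k(M∖i). When T is a flat of M, submodularity makes
-- T∖i a flat of M∖i unless it is empty or all of E∖i, and there the formula
-- min(|T∖i|,k) − k|T∖i|/n for that coefficient vanishes anyway. Subtracting, the coefficient of
-- x_T in the difference of the two sides is α(|T| − (n+1)[i ∈ T]) with α = k/n − K/(n+1), K and k
-- being the indices of γ_K(M) and γ_k(M∖i): the min-terms cancel against the correction sum and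
-- what remains is linear in |T|. So the difference is α · Σ_a (Σ_{F∋a} x_F − Σ_{F∋i} x_F), a
-- combination of the linear relations.

module Submission where

open import Defs
open import Algebra.Bundles using (Ring)
open import Data.Bool as Bool using (Bool; true; false; if_then_else_; _∧_; not)
import Data.Bool.Properties as BoolP
open import Data.Fin as Fin using (Fin; zero; suc; punchIn)
import Data.Fin.Properties as FinP
open import Data.Fin.Subset
  using (Subset; _∈_; _∉_; _⊆_; ⁅_⁆; _∪_; _∩_; _─_; _-_; ∣_∣; ⊤; ⊥; inside; outside)
open import Data.Fin.Subset.Properties
open import Data.Integer as ℤ using (+_)
import Data.Integer.Properties as ℤP
open import Data.Integer.Solver using (module +-*-Solver)
open import Data.List as List using (List; foldr; tabulate; allFin)
import Data.List.Properties as ListP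
import Data.List.Relation.Unary.All as All
open import Data.Nat as ℕ using (ℕ; zero; suc; _≤_; _⊓_; _∸_; _≤?_)
import Data.Nat.Properties as ℕP
open import Data.Product using (_×_; _,_)
open import Data.Rational as ℚ using (ℚ; 0ℚ; 1ℚ; toℚᵘ)
import Data.Rational.Properties as ℚP
import Data.Rational.Solver as ℚSolver
open import Data.Rational.Unnormalised as ℚᵘ using (mkℚᵘ; *≡*)
import Data.Rational.Unnormalised.Properties as ℚᵘP
open import Data.Sum using (_⊎_; inj₁; inj₂)
open import Data.Vec using ([]; _∷_; here; there)
import Data.Vec.Properties as VecP
open import Function using (_∘_)
open import Relation.Binary.PropositionalEquality
open import Relation.Nullary using (¬_; Dec; yes; no; does; ¬?; contradiction)
open import Relation.Nullary.Decidable using (dec-true; dec-false)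

open import Algebra.Properties.Semiring.Sum (Ring.semiring ℚP.+-*-ring)
  using (sum; sum-remove; sum-cong-≗; sum-replicate-zero; *-distribˡ-sum)

-- Normalising division does not compute on variables, so these identities are checked on
-- unnormalised rationals, where they are cross-multiplications in ℤ.
toℚᵘ-divℕ : ∀ a b → toℚᵘ (divℕ a (suc b)) ℚᵘ.≃ mkℚᵘ (+ a) b
toℚᵘ-divℕ a b = ℚP.toℚᵘ-fromℚᵘ (mkℚᵘ (+ a) b)

ℕ→ℚ-+ : ∀ a b → ℕ→ℚ (a ℕ.+ b) ≡ ℕ→ℚ a ℚ.+ ℕ→ℚ b
ℕ→ℚ-+ a b = ℚP.toℚᵘ-injective (begin-equality
  toℚᵘ (ℕ→ℚ (a ℕ.+ b))             ≃⟨ toℚᵘ-divℕ (a ℕ.+ b) 0 ⟩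
  mkℚᵘ (+ (a ℕ.+ b)) 0             ≃⟨ *≡* (solve 2 (λ a b → (a :+ b) :* con (+ 1)
                                                       := (a :* con (+ 1) :+ b :* con (+ 1)) :* con (+ 1))
                                                   refl (+ a) (+ b)) ⟩
  mkℚᵘ (+ a) 0 ℚᵘ.+ mkℚᵘ (+ b) 0   ≃⟨ ℚᵘP.+-cong (toℚᵘ-divℕ a 0) (toℚᵘ-divℕ b 0) ⟨
  toℚᵘ (ℕ→ℚ a) ℚᵘ.+ toℚᵘ (ℕ→ℚ b)   ≃⟨ ℚP.toℚᵘ-homo-+ (ℕ→ℚ a) (ℕ→ℚ b) ⟨
  toℚᵘ (ℕ→ℚ a ℚ.+ ℕ→ℚ b)           ∎)
  where
  open ℚᵘP.≤-Reasoning
  open +-*-Solver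

ℕ→ℚ-suc : ∀ a → ℕ→ℚ (suc a) ≡ 1ℚ ℚ.+ ℕ→ℚ a
ℕ→ℚ-suc = ℕ→ℚ-+ 1

divℕ-* : ∀ k s u → divℕ (k ℕ.* s) u ≡ ℕ→ℚ s ℚ.* divℕ k u
divℕ-* k s zero    = sym (ℚP.*-zeroʳ (ℕ→ℚ s))
divℕ-* k s (suc b) = ℚP.toℚᵘ-injective (begin-equality
  toℚᵘ (divℕ (k ℕ.* s) (suc b))              ≃⟨ toℚᵘ-divℕ (k ℕ.* s) b ⟩
  mkℚᵘ (+ (k ℕ.* s)) b                       ≃⟨ *≡* (trans (cong (ℤ._* + suc (b ℕ.+ 0)) (ℤP.pos-* k s))
                                                      (solve 3 (λ k s b → (k :* s) :* (con (+ 1) :+ (b :+ con (+ 0)))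
                                                                          := (s :* k) :* (con (+ 1) :+ b))
                                                             refl (+ k) (+ s) (+ b))) ⟩
  mkℚᵘ (+ s) 0 ℚᵘ.* mkℚᵘ (+ k) b             ≃⟨ ℚᵘP.*-cong (toℚᵘ-divℕ s 0) (toℚᵘ-divℕ k b) ⟨
  toℚᵘ (ℕ→ℚ s) ℚᵘ.* toℚᵘ (divℕ k (suc b))    ≃⟨ ℚP.toℚᵘ-homo-* (ℕ→ℚ s) (divℕ k (suc b)) ⟨
  toℚᵘ (ℕ→ℚ s ℚ.* divℕ k (suc b))            ∎)
  where
  open ℚᵘP.≤-Reasoning
  open +-*-Solver

*-divℕ : ∀ a b → ℕ→ℚ (suc b) ℚ.* divℕ a (suc b) ≡ ℕ→ℚ a
*-divℕ a b = ℚP.toℚᵘ-injective (begin-equality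
  toℚᵘ (ℕ→ℚ (suc b) ℚ.* divℕ a (suc b))            ≃⟨ ℚP.toℚᵘ-homo-* (ℕ→ℚ (suc b)) (divℕ a (suc b)) ⟩
  toℚᵘ (ℕ→ℚ (suc b)) ℚᵘ.* toℚᵘ (divℕ a (suc b))    ≃⟨ ℚᵘP.*-cong (toℚᵘ-divℕ (suc b) 0) (toℚᵘ-divℕ a b) ⟩
  mkℚᵘ (+ suc b) 0 ℚᵘ.* mkℚᵘ (+ a) b               ≃⟨ *≡* (solve 2 (λ a b → ((con (+ 1) :+ b) :* a) :* con (+ 1)
                                                                      := a :* (con (+ 1) :+ (b :+ con (+ 0))))
                                                                 refl (+ a) (+ b)) ⟩
  mkℚᵘ (+ a) 0                                      ≃⟨ toℚᵘ-divℕ a 0 ⟨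
  toℚᵘ (ℕ→ℚ a)                                      ∎)
  where
  open ℚᵘP.≤-Reasoning
  open +-*-Solver

𝟙 : Bool → ℚ
𝟙 b = if b then 1ℚ else 0ℚ

ℕ→ℚ-⊓-suc : ∀ s k → ℕ→ℚ (s ⊓ suc k) ≡ ℕ→ℚ (s ⊓ k) ℚ.+ 𝟙 (does (suc k ≤? s))
ℕ→ℚ-⊓-suc s k = by-cases (suc k ≤? s)
  where
  open ≡-Reasoning
  by-cases : (k<s? : Dec (suc k ≤ s)) → ℕ→ℚ (s ⊓ suc k) ≡ ℕ→ℚ (s ⊓ k) ℚ.+ 𝟙 (does k<s?)
  by-cases (yes k<s) = begin
    ℕ→ℚ (s ⊓ suc k)      ≡⟨ cong ℕ→ℚ (ℕP.m≥n⇒m⊓n≡n k<s) ⟩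
    ℕ→ℚ (suc k)          ≡⟨ ℕ→ℚ-suc k ⟩
    1ℚ ℚ.+ ℕ→ℚ k         ≡⟨ ℚP.+-comm 1ℚ (ℕ→ℚ k) ⟩
    ℕ→ℚ k ℚ.+ 1ℚ         ≡⟨ cong (λ z → ℕ→ℚ z ℚ.+ 1ℚ) (ℕP.m≥n⇒m⊓n≡n (ℕP.<⇒≤ k<s)) ⟨
    ℕ→ℚ (s ⊓ k) ℚ.+ 1ℚ   ∎
  by-cases (no k≮s) = begin
    ℕ→ℚ (s ⊓ suc k)      ≡⟨ cong ℕ→ℚ (ℕP.m≤n⇒m⊓n≡m (ℕP.m≤n⇒m≤1+n s≤k)) ⟩
    ℕ→ℚ s                ≡⟨ cong ℕ→ℚ (ℕP.m≤n⇒m⊓n≡m s≤k) ⟨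
    ℕ→ℚ (s ⊓ k)          ≡⟨ ℚP.+-identityʳ (ℕ→ℚ (s ⊓ k)) ⟨
    ℕ→ℚ (s ⊓ k) ℚ.+ 0ℚ   ∎
    where
    s≤k : s ≤ k
    s≤k = ℕP.≮⇒≥ k≮s

ℕ→ℚ-suc-⊓ : ∀ t l → ℕ→ℚ (suc t ⊓ l) ≡ ℕ→ℚ (t ⊓ l) ℚ.+ 𝟙 (does (suc t ≤? l))
ℕ→ℚ-suc-⊓ t l = begin
  ℕ→ℚ (suc t ⊓ l)                        ≡⟨ cong ℕ→ℚ (ℕP.⊓-comm (suc t) l) ⟩
  ℕ→ℚ (l ⊓ suc t)                        ≡⟨ ℕ→ℚ-⊓-suc l t ⟩
  ℕ→ℚ (l ⊓ t) ℚ.+ 𝟙 (does (suc t ≤? l))  ≡⟨ cong (λ z → ℕ→ℚ z ℚ.+ 𝟙 (does (suc t ≤? l))) (ℕP.⊓-comm l t) ⟩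
  ℕ→ℚ (t ⊓ l) ℚ.+ 𝟙 (does (suc t ≤? l))  ∎
  where open ≡-Reasoning

≡-by-diff : ∀ {x y a b : ℚ} → x ≡ y ℚ.+ (a ℚ.- b) → a ≡ b → x ≡ y
≡-by-diff {y = y} {b = b} x≡y+[b-b] refl =
  trans x≡y+[b-b] (trans (cong (y ℚ.+_) (ℚP.+-inverseʳ b)) (ℚP.+-identityʳ y))

γ-coeff : ℕ → ℕ → ℕ → ℚ
γ-coeff u k s = ℕ→ℚ (s ⊓ k) ℚ.- divℕ (k ℕ.* s) u

γ-coeff-comm : ∀ u k s → γ-coeff u k s ≡ γ-coeff u s k
γ-coeff-comm u k s = cong₂ ℚ._-_ (cong ℕ→ℚ (ℕP.⊓-comm s k)) (cong (λ z → divℕ z u) (ℕP.*-comm k s))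

γ-coeff-linear : ∀ u k s → γ-coeff u k s ≡ ℕ→ℚ (s ⊓ k) ℚ.- ℕ→ℚ s ℚ.* divℕ k u
γ-coeff-linear u k s = cong (λ z → ℕ→ℚ (s ⊓ k) ℚ.- z) (divℕ-* k s u)

γ-coeff-empty : ∀ u k → γ-coeff u k 0 ≡ 0ℚ
γ-coeff-empty u k = begin
  0ℚ ℚ.- divℕ (k ℕ.* 0) u   ≡⟨ cong (λ z → 0ℚ ℚ.- z) (trans (divℕ-* k 0 u) (ℚP.*-zeroˡ (divℕ k u))) ⟩
  0ℚ ℚ.- 0ℚ                 ≡⟨ ℚP.+-inverseʳ 0ℚ ⟩
  0ℚ                        ∎
  where open ≡-Reasoning

γ-coeff-full : ∀ u k → k ≤ u → γ-coeff u k u ≡ 0ℚ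
γ-coeff-full zero    k _   = γ-coeff-empty 0 k
γ-coeff-full (suc b) k k≤u = begin
  ℕ→ℚ (suc b ⊓ k) ℚ.- divℕ (k ℕ.* suc b) (suc b)
    ≡⟨ cong₂ ℚ._-_ (cong ℕ→ℚ (ℕP.m≥n⇒m⊓n≡n k≤u)) (trans (divℕ-* k (suc b) (suc b)) (*-divℕ k b)) ⟩
  ℕ→ℚ k ℚ.- ℕ→ℚ k
    ≡⟨ ℚP.+-inverseʳ (ℕ→ℚ k) ⟩
  0ℚ ∎
  where open ≡-Reasoning

module _ (n K k : ℕ) where

  private
    A B : ℚ
    A = divℕ k (suc n)
    B = divℕ K (suc (suc n))

  γ-coeff-deletion-∉ : ∀ s c → ℕ→ℚ (s ⊓ K) ≡ ℕ→ℚ (s ⊓ k) ℚ.+ c →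
    γ-coeff (suc (suc n)) K s ℚ.- (γ-coeff (suc n) k s ℚ.+ c)
      ≡ (A ℚ.- B) ℚ.* (ℕ→ℚ s ℚ.- ℕ→ℚ (suc (suc n)) ℚ.* 0ℚ)
  γ-coeff-deletion-∉ s c min-step = begin
    γ-coeff (suc (suc n)) K s ℚ.- (γ-coeff (suc n) k s ℚ.+ c)
      ≡⟨ cong₂ (λ a b → a ℚ.- (b ℚ.+ c)) (γ-coeff-linear (suc (suc n)) K s) (γ-coeff-linear (suc n) k s) ⟩
    (P ℚ.- σ ℚ.* B) ℚ.- ((Q ℚ.- σ ℚ.* A) ℚ.+ c)
      ≡⟨ cong (λ z → (z ℚ.- σ ℚ.* B) ℚ.- ((Q ℚ.- σ ℚ.* A) ℚ.+ c)) min-step ⟩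
    ((Q ℚ.+ c) ℚ.- σ ℚ.* B) ℚ.- ((Q ℚ.- σ ℚ.* A) ℚ.+ c)
      ≡⟨ solve 6 (λ Q c σ A B M → ((Q :+ c) :- σ :* B) :- ((Q :- σ :* A) :+ c)
                                  := (A :- B) :* (σ :- M :* con 0ℚ))
               refl Q c σ A B (ℕ→ℚ (suc (suc n))) ⟩
    (A ℚ.- B) ℚ.* (σ ℚ.- ℕ→ℚ (suc (suc n)) ℚ.* 0ℚ) ∎
    where
    open ≡-Reasoning
    open ℚSolver.+-*-Solver
    σ P Q : ℚ
    σ = ℕ→ℚ s
    P = ℕ→ℚ (s ⊓ K)
    Q = ℕ→ℚ (s ⊓ k)

  -- The remainder P + uA − (Q + c + (1+u)B) vanishes because uA = k and (1+u)B = K.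
  γ-coeff-deletion-∈ : ∀ t c → ℕ→ℚ (suc t ⊓ K) ℚ.+ ℕ→ℚ k ≡ ℕ→ℚ (t ⊓ k) ℚ.+ c ℚ.+ ℕ→ℚ K →
    γ-coeff (suc (suc n)) K (suc t) ℚ.- (γ-coeff (suc n) k t ℚ.+ c)
      ≡ (A ℚ.- B) ℚ.* (ℕ→ℚ (suc t) ℚ.- ℕ→ℚ (suc (suc n)) ℚ.* 1ℚ)
  γ-coeff-deletion-∈ t c min-step = ≡-by-diff (begin
    γ-coeff (suc (suc n)) K (suc t) ℚ.- (γ-coeff (suc n) k t ℚ.+ c)
      ≡⟨ cong₂ (λ a b → a ℚ.- (b ℚ.+ c)) (γ-coeff-linear (suc (suc n)) K (suc t)) (γ-coeff-linear (suc n) k t) ⟩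
    (P ℚ.- ℕ→ℚ (suc t) ℚ.* B) ℚ.- ((Q ℚ.- τ ℚ.* A) ℚ.+ c)
      ≡⟨ cong (λ z → (P ℚ.- z ℚ.* B) ℚ.- ((Q ℚ.- τ ℚ.* A) ℚ.+ c)) (ℕ→ℚ-suc t) ⟩
    (P ℚ.- (1ℚ ℚ.+ τ) ℚ.* B) ℚ.- ((Q ℚ.- τ ℚ.* A) ℚ.+ c)
      ≡⟨ solve 7 (λ P Q c τ u A B → (P :- (con 1ℚ :+ τ) :* B) :- ((Q :- τ :* A) :+ c)
                 := (A :- B) :* ((con 1ℚ :+ τ) :- (con 1ℚ :+ u) :* con 1ℚ)
                    :+ ((P :+ u :* A) :- ((Q :+ c) :+ (con 1ℚ :+ u) :* B)))
               refl P Q c τ u A B ⟩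
    (A ℚ.- B) ℚ.* ((1ℚ ℚ.+ τ) ℚ.- (1ℚ ℚ.+ u) ℚ.* 1ℚ) ℚ.+ remainder
      ≡⟨ cong (λ z → (A ℚ.- B) ℚ.* z ℚ.+ remainder)
              (cong₂ (λ a b → a ℚ.- b ℚ.* 1ℚ) (ℕ→ℚ-suc t) (ℕ→ℚ-suc (suc n))) ⟨
    (A ℚ.- B) ℚ.* (ℕ→ℚ (suc t) ℚ.- ℕ→ℚ (suc (suc n)) ℚ.* 1ℚ) ℚ.+ remainder ∎)
    (begin
    P ℚ.+ u ℚ.* A                         ≡⟨ cong (P ℚ.+_) (*-divℕ k n) ⟩
    P ℚ.+ ℕ→ℚ k                           ≡⟨ min-step ⟩
    Q ℚ.+ c ℚ.+ ℕ→ℚ K                     ≡⟨ cong (Q ℚ.+ c ℚ.+_) (*-divℕ K (suc n)) ⟨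
    Q ℚ.+ c ℚ.+ ℕ→ℚ (suc (suc n)) ℚ.* B   ≡⟨ cong (λ z → Q ℚ.+ c ℚ.+ z ℚ.* B) (ℕ→ℚ-suc (suc n)) ⟩
    Q ℚ.+ c ℚ.+ (1ℚ ℚ.+ u) ℚ.* B          ∎)
    where
    open ≡-Reasoning
    open ℚSolver.+-*-Solver
    τ u P Q remainder : ℚ
    τ = ℕ→ℚ t
    u = ℕ→ℚ (suc n)
    P = ℕ→ℚ (suc t ⊓ K)
    Q = ℕ→ℚ (t ⊓ k)
    remainder = (P ℚ.+ u ℚ.* A) ℚ.- ((Q ℚ.+ c) ℚ.+ (1ℚ ℚ.+ u) ℚ.* B)

x∉p-x : ∀ {n} (p : Subset n) x → x ∉ p - x
x∉p-x (_ ∷ p) (suc x) (there x∈p-x) = x∉p-x p x x∈p-x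

x∈p-y⇒x≢y : ∀ {n} {p : Subset n} {x y} → x ∈ p - y → x ≢ y
x∈p-y⇒x≢y {p = p} x∈p-x refl = x∉p-x p _ x∈p-x

x∉p⇒p-x≡p : ∀ {n} {p : Subset n} {x} → x ∉ p → p - x ≡ p
x∉p⇒p-x≡p {p = outside ∷ p} {zero}  _   = cong (outside ∷_) (p─⊥≡p p)
x∉p⇒p-x≡p {p = inside  ∷ p} {zero}  x∉p = contradiction here x∉p
x∉p⇒p-x≡p {p = b       ∷ p} {suc x} x∉p = cong (b ∷_) (x∉p⇒p-x≡p (x∉p ∘ there))

x∈p⇒p-x∪⁅x⁆≡p : ∀ {n} {p : Subset n} {x} → x ∈ p → (p - x) ∪ ⁅ x ⁆ ≡ p
x∈p⇒p-x∪⁅x⁆≡p {p = _ ∷ p} here        = cong (inside ∷_) (trans (∪-identityʳ (p ─ ⊥)) (p─⊥≡p p))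
x∈p⇒p-x∪⁅x⁆≡p {p = b ∷ p} (there x∈p) = cong₂ _∷_ (BoolP.∨-identityʳ b) (x∈p⇒p-x∪⁅x⁆≡p x∈p)

x∉p⇒p∪⁅x⁆-x≡p : ∀ {n} {p : Subset n} {x} → x ∉ p → (p ∪ ⁅ x ⁆) - x ≡ p
x∉p⇒p∪⁅x⁆-x≡p {p = outside ∷ p} {zero}  _   = cong (outside ∷_) (trans (p─⊥≡p (p ∪ ⊥)) (∪-identityʳ p))
x∉p⇒p∪⁅x⁆-x≡p {p = inside  ∷ p} {zero}  x∉p = contradiction here x∉p
x∉p⇒p∪⁅x⁆-x≡p {p = b       ∷ p} {suc x} x∉p =
  cong₂ _∷_ (BoolP.∨-identityʳ b) (x∉p⇒p∪⁅x⁆-x≡p (x∉p ∘ there))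

x∈p⇒suc∣p-x∣≡∣p∣ : ∀ {n} {p : Subset n} {x} → x ∈ p → suc ∣ p - x ∣ ≡ ∣ p ∣
x∈p⇒suc∣p-x∣≡∣p∣ {p = _       ∷ p} here        = cong (suc ∘ ∣_∣) (p─⊥≡p p)
x∈p⇒suc∣p-x∣≡∣p∣ {p = inside  ∷ p} (there x∈p) = cong suc (x∈p⇒suc∣p-x∣≡∣p∣ x∈p)
x∈p⇒suc∣p-x∣≡∣p∣ {p = outside ∷ p} (there x∈p) = x∈p⇒suc∣p-x∣≡∣p∣ x∈p

∣⊤-x∣≡n : ∀ n (x : Fin (suc n)) → ∣ ⊤ - x ∣ ≡ n
∣⊤-x∣≡n n x = ℕP.suc-injective (trans (x∈p⇒suc∣p-x∣≡∣p∣ {p = ⊤} {x} ∈⊤) (∣⊤∣≡n (suc n)))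

∪-lub : ∀ {n} {p q r : Subset n} → p ⊆ r → q ⊆ r → p ∪ q ⊆ r
∪-lub {p = p} {q} p⊆r q⊆r x∈p∪q with x∈p∪q⁻ p q x∈p∪q
... | inj₁ x∈p = p⊆r x∈p
... | inj₂ x∈q = q⊆r x∈q

foldr-⊕-apply : ∀ {A : Set} {m} (f : A → Lin m) (as : List A) T →
  foldr (λ a acc → f a ⊕ acc) 0L as T ≡ foldr (λ a → f a T ℚ.+_) 0ℚ as
foldr-⊕-apply f as T = ListP.foldr-fusion (λ v → v T) 0L (λ _ _ → refl) as

foldr-+-zeros : ∀ {A : Set} (g : A → ℚ) q (as : List A) → (∀ a → g a ≡ 0ℚ) →
  foldr (λ a → g a ℚ.+_) q as ≡ q
foldr-+-zeros g q List.[]       _   = refl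
foldr-+-zeros g q (a List.∷ as) g≡0 =
  trans (cong₂ ℚ._+_ (g≡0 a) (foldr-+-zeros g q as g≡0)) (ℚP.+-identityˡ q)

foldr-+-allSubsets : ∀ m (g : Subset m → ℚ) S₀ → (∀ S → S ≢ S₀ → g S ≡ 0ℚ) → ∀ q →
  foldr (λ S → g S ℚ.+_) q (allSubsets m) ≡ g S₀ ℚ.+ q
foldr-+-allSubsets zero    g [] _ q = refl
foldr-+-allSubsets (suc m) g (b ∷ S₀) off q = begin
  foldr G q (List.map (false ∷_) L List.++ List.map (true ∷_) L)
    ≡⟨ ListP.foldr-++ G q (List.map (false ∷_) L) (List.map (true ∷_) L) ⟩
  foldr G (foldr G q (List.map (true ∷_) L)) (List.map (false ∷_) L)
    ≡⟨ ListP.foldr-map G (false ∷_) _ L ⟩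
  foldr (G ∘ (false ∷_)) (foldr G q (List.map (true ∷_) L)) L
    ≡⟨ cong (λ q′ → foldr (G ∘ (false ∷_)) q′ L) (ListP.foldr-map G (true ∷_) q L) ⟩
  foldr (G ∘ (false ∷_)) (foldr (G ∘ (true ∷_)) q L) L
    ≡⟨ by-head b off ⟩
  g (b ∷ S₀) ℚ.+ q ∎
  where
  open ≡-Reasoning
  L : List (Subset m)
  L = allSubsets m
  G : Subset (suc m) → ℚ → ℚ
  G S = g S ℚ.+_
  off-tail : ∀ {b} → (∀ S → S ≢ b ∷ S₀ → g S ≡ 0ℚ) → ∀ S → S ≢ S₀ → g (b ∷ S) ≡ 0ℚ
  off-tail off S S≢S₀ = off _ (S≢S₀ ∘ VecP.∷-injectiveʳ)
  by-head : ∀ b → (∀ S → S ≢ b ∷ S₀ → g S ≡ 0ℚ) →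
    foldr (G ∘ (false ∷_)) (foldr (G ∘ (true ∷_)) q L) L ≡ g (b ∷ S₀) ℚ.+ q
  by-head false off = trans (cong (λ q′ → foldr (G ∘ (false ∷_)) q′ L)
                                  (foldr-+-zeros _ q L (λ S → off _ λ ())))
                            (foldr-+-allSubsets m _ S₀ (off-tail off) q)
  by-head true  off = trans (foldr-+-zeros _ _ L (λ S → off _ λ ()))
                            (foldr-+-allSubsets m _ S₀ (off-tail off) q)

ΣS-single : ∀ {m} (f : Subset m → Lin m) S₀ T → (∀ S → S ≢ S₀ → f S T ≡ 0ℚ) → ΣS f T ≡ f S₀ T
ΣS-single {m} f S₀ T off = begin
  ΣS f T                                       ≡⟨ foldr-⊕-apply f (allSubsets m) T ⟩
  foldr (λ S → f S T ℚ.+_) 0ℚ (allSubsets m)   ≡⟨ foldr-+-allSubsets m (λ S → f S T) S₀ off 0ℚ ⟩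
  f S₀ T ℚ.+ 0ℚ                                ≡⟨ ℚP.+-identityʳ (f S₀ T) ⟩
  f S₀ T                                       ∎
  where open ≡-Reasoning

foldr-+-tabulate : ∀ {A : Set} {m} (g : A → ℚ) (h : Fin m → A) →
  foldr (λ a → g a ℚ.+_) 0ℚ (tabulate h) ≡ sum (g ∘ h)
foldr-+-tabulate {m = zero}  g h = refl
foldr-+-tabulate {m = suc m} g h = cong (g (h zero) ℚ.+_) (foldr-+-tabulate g (h ∘ suc))

ΣE-⊤ : ∀ {m} (f : Fin m → Lin m) T → ΣE ⊤ f T ≡ sum (λ a → f a T)
ΣE-⊤ {m} f T = begin
  ΣE ⊤ f T
    ≡⟨ cong (λ as → foldr (λ a acc → f a ⊕ acc) 0L as T)
            (ListP.filter-all (_∈? ⊤) (All.universal (λ _ → ∈⊤) (allFin m))) ⟩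
  foldr (λ a acc → f a ⊕ acc) 0L (allFin m) T
    ≡⟨ foldr-⊕-apply f (allFin m) T ⟩
  foldr (λ a → f a T ℚ.+_) 0ℚ (allFin m)
    ≡⟨ foldr-+-tabulate (λ a → f a T) (λ a → a) ⟩
  sum (λ a → f a T) ∎
  where open ≡-Reasoning

sum-single : ∀ {m} (g : Fin m → ℚ) i → (∀ j → j ≢ i → g j ≡ 0ℚ) → sum g ≡ g i
sum-single {suc m} g i off = begin
  sum g                         ≡⟨ sum-remove {i = i} g ⟩
  g i ℚ.+ sum (g ∘ punchIn i)   ≡⟨ cong (g i ℚ.+_) (trans (sum-cong-≗ (λ j → off _ (FinP.punchInᵢ≢i i j)))
                                                          (sum-replicate-zero m)) ⟩
  g i ℚ.+ 0ℚ                    ≡⟨ ℚP.+-identityʳ (g i) ⟩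
  g i                           ∎
  where open ≡-Reasoning

sum-𝟙-∈ : ∀ {m} (T : Subset m) c → sum (λ a → 𝟙 (does (a ∈? T)) ℚ.- c) ≡ ℕ→ℚ ∣ T ∣ ℚ.- ℕ→ℚ m ℚ.* c
sum-𝟙-∈ [] c = solve 1 (λ c → con 0ℚ := con 0ℚ :- con 0ℚ :* c) refl c
  where open ℚSolver.+-*-Solver
sum-𝟙-∈ {suc m} (inside ∷ T) c = begin
  (1ℚ ℚ.- c) ℚ.+ sum (λ a → 𝟙 (does (a ∈? T)) ℚ.- c)
    ≡⟨ cong ((1ℚ ℚ.- c) ℚ.+_) (sum-𝟙-∈ T c) ⟩
  (1ℚ ℚ.- c) ℚ.+ (t ℚ.- ℕ→ℚ m ℚ.* c)
    ≡⟨ solve 3 (λ c t m → (con 1ℚ :- c) :+ (t :- m :* c) := (con 1ℚ :+ t) :- (con 1ℚ :+ m) :* c)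
             refl c t (ℕ→ℚ m) ⟩
  (1ℚ ℚ.+ t) ℚ.- (1ℚ ℚ.+ ℕ→ℚ m) ℚ.* c
    ≡⟨ cong₂ (λ t′ m′ → t′ ℚ.- m′ ℚ.* c) (ℕ→ℚ-suc ∣ T ∣) (ℕ→ℚ-suc m) ⟨
  ℕ→ℚ (suc ∣ T ∣) ℚ.- ℕ→ℚ (suc m) ℚ.* c ∎
  where
  open ≡-Reasoning
  open ℚSolver.+-*-Solver
  t : ℚ
  t = ℕ→ℚ ∣ T ∣
sum-𝟙-∈ {suc m} (outside ∷ T) c = begin
  (0ℚ ℚ.- c) ℚ.+ sum (λ a → 𝟙 (does (a ∈? T)) ℚ.- c)
    ≡⟨ cong ((0ℚ ℚ.- c) ℚ.+_) (sum-𝟙-∈ T c) ⟩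
  (0ℚ ℚ.- c) ℚ.+ (t ℚ.- ℕ→ℚ m ℚ.* c)
    ≡⟨ solve 3 (λ c t m → (con 0ℚ :- c) :+ (t :- m :* c) := t :- (con 1ℚ :+ m) :* c)
             refl c t (ℕ→ℚ m) ⟩
  t ℚ.- (1ℚ ℚ.+ ℕ→ℚ m) ℚ.* c
    ≡⟨ cong (λ m′ → t ℚ.- m′ ℚ.* c) (ℕ→ℚ-suc m) ⟨
  t ℚ.- ℕ→ℚ (suc m) ℚ.* c ∎
  where
  open ≡-Reasoning
  open ℚSolver.+-*-Solver
  t : ℚ
  t = ℕ→ℚ ∣ T ∣

x-off : ∀ {m} (N : RawMatroid m) {S T} → S ≢ T → x N S T ≡ 0ℚ
x-off N {S} {T} S≢T =
  cong 𝟙 (trans (cong (does (isNPFlat? N S) ∧_) (dec-false (VecP.≡-dec Bool._≟_ T S) (S≢T ∘ sym)))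
                (BoolP.∧-zeroʳ _))

x-diag : ∀ {m} (N : RawMatroid m) T → x N T T ≡ 𝟙 (does (isNPFlat? N T))
x-diag N T = cong 𝟙 (trans (cong (does (isNPFlat? N T) ∧_) (dec-true (VecP.≡-dec Bool._≟_ T T) refl))
                           (BoolP.∧-identityʳ _))

x-flat : ∀ {m} (N : RawMatroid m) {T} → IsNPFlat N T → x N T T ≡ 1ℚ
x-flat N {T} flat = trans (x-diag N T) (cong 𝟙 (dec-true (isNPFlat? N T) flat))

x-nonflat : ∀ {m} (N : RawMatroid m) {S} T → ¬ IsNPFlat N S → x N S T ≡ 0ℚ
x-nonflat N {S} T ¬flat = cong (λ b → 𝟙 (b ∧ _)) (dec-false (isNPFlat? N S) ¬flat)

x-coeff-cong : ∀ {m} (N : RawMatroid m) S {c c′} → (IsNPFlat N S → c ≡ c′) →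
  c ℚ.* x N S S ≡ c′ ℚ.* x N S S
x-coeff-cong N S {c} {c′} c≡c′ with isNPFlat? N S
... | yes flat = cong (ℚ._* x N S S) (c≡c′ flat)
... | no ¬flat rewrite x-nonflat N S ¬flat = trans (ℚP.*-zeroʳ c) (sym (ℚP.*-zeroʳ c′))

ΣS-coeff-apply : ∀ {m} (N : RawMatroid m) (c : Subset m → ℚ) T →
  ΣS (λ S → c S ⊙ x N S) T ≡ c T ℚ.* x N T T
ΣS-coeff-apply N c T = ΣS-single (λ S → c S ⊙ x N S) T T
  (λ S S≢T → trans (cong (c S ℚ.*_) (x-off N S≢T)) (ℚP.*-zeroʳ (c S)))

ΣS-indicator-apply : ∀ {m} (N : RawMatroid m) (c : Subset m → Bool) T →
  ΣS (λ S → if c S then x N S else 0L) T ≡ 𝟙 (c T) ℚ.* x N T T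
ΣS-indicator-apply N c T = trans (ΣS-single (λ S → if c S then x N S else 0L) T T off) (on-diagonal (c T))
  where
  off : ∀ S → S ≢ T → (if c S then x N S else 0L) T ≡ 0ℚ
  off S S≢T with c S
  ... | true  = x-off N S≢T
  ... | false = refl
  on-diagonal : ∀ b → (if b then x N T else 0L) T ≡ 𝟙 b ℚ.* x N T T
  on-diagonal true  = sym (ℚP.*-identityˡ (x N T T))
  on-diagonal false = sym (ℚP.*-zeroˡ (x N T T))

-- Outside 1 ≤ k ≤ u − 1 the class γ_k is 0 by definition; the formula still holds there
-- because γ-coeff vanishes for k = 0, and for k = u on subsets of the ground set.
γ-apply : ∀ {m} (N : RawMatroid m) {u} k S → ∣ ground N ∣ ≡ u → k ≤ u →
  γ N k S ≡ γ-coeff u k ∣ S ∣ ℚ.* x N S S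
γ-apply N zero S refl _ = sym (begin
  γ-coeff u 0 ∣ S ∣ ℚ.* x N S S   ≡⟨ cong (ℚ._* x N S S) (γ-coeff-comm u 0 ∣ S ∣) ⟩
  γ-coeff u ∣ S ∣ 0 ℚ.* x N S S   ≡⟨ cong (ℚ._* x N S S) (γ-coeff-empty u ∣ S ∣) ⟩
  0ℚ ℚ.* x N S S                  ≡⟨ ℚP.*-zeroˡ (x N S S) ⟩
  0ℚ                              ∎)
  where
  open ≡-Reasoning
  u : ℕ
  u = ∣ ground N ∣
γ-apply N (suc k) S refl k<u = by-range (suc k ≤? u ∸ 1)
  where
  open ≡-Reasoning
  u : ℕ
  u = ∣ ground N ∣
  by-range : (k<u-1? : Dec (suc k ≤ u ∸ 1)) →
    (if does k<u-1? then ΣS (λ T → γ-coeff u (suc k) ∣ T ∣ ⊙ x N T) else 0L) S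
      ≡ γ-coeff u (suc k) ∣ S ∣ ℚ.* x N S S
  by-range (yes _)      = ΣS-coeff-apply N (λ T → γ-coeff u (suc k) ∣ T ∣) S
  by-range (no k≮u-1) = sym (trans (x-coeff-cong N S top-vanishes) (ℚP.*-zeroˡ (x N S S)))
    where
    k≡u : suc k ≡ u
    k≡u = ℕP.≤-antisym k<u (ℕP.≤-trans (ℕP.m≤n+m∸n u 1) (ℕP.≰⇒> k≮u-1))
    top-vanishes : IsNPFlat N S → γ-coeff u (suc k) ∣ S ∣ ≡ 0ℚ
    top-vanishes (S⊆U , _) = begin
      γ-coeff u (suc k) ∣ S ∣   ≡⟨ cong (λ k′ → γ-coeff u k′ ∣ S ∣) k≡u ⟩
      γ-coeff u u ∣ S ∣         ≡⟨ γ-coeff-comm u u ∣ S ∣ ⟩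
      γ-coeff u ∣ S ∣ u         ≡⟨ γ-coeff-full u ∣ S ∣ (p⊆q⇒∣p∣≤∣q∣ S⊆U) ⟩
      0ℚ                        ∎

rel-apply : ∀ {m} (N : RawMatroid m) a b T →
  rel N a b T ≡ x N T T ℚ.* (𝟙 (does (a ∈? T)) ℚ.- 𝟙 (does (b ∈? T)))
rel-apply N a b T = begin
  rel N a b T
    ≡⟨ cong₂ ℚ._-_ (ΣS-indicator-apply N (λ F → does (a ∈? F)) T)
                   (ΣS-indicator-apply N (λ F → does (b ∈? F)) T) ⟩
  ιa ℚ.* x N T T ℚ.- ιb ℚ.* x N T T
    ≡⟨ solve 3 (λ ιa ιb χ → ιa :* χ :- ιb :* χ := χ :* (ιa :- ιb)) refl ιa ιb (x N T T) ⟩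
  x N T T ℚ.* (ιa ℚ.- ιb) ∎
  where
  open ≡-Reasoning
  open ℚSolver.+-*-Solver
  ιa ιb : ℚ
  ιa = 𝟙 (does (a ∈? T))
  ιb = 𝟙 (does (b ∈? T))

relCoeff : ∀ {m} → Fin m → ℚ → Fin m → Fin m → ℚ
relCoeff i α a b = if does (b Fin.≟ i) then α else 0ℚ

Σrel-apply : ∀ {m} (r : Subset m → ℕ) i α T →
  ΣE ⊤ (λ a → ΣE ⊤ (λ b → relCoeff i α a b ⊙ rel (mkRaw ⊤ r) a b)) T
    ≡ α ℚ.* (x (mkRaw ⊤ r) T T ℚ.* (ℕ→ℚ ∣ T ∣ ℚ.- ℕ→ℚ m ℚ.* 𝟙 (does (i ∈? T))))
Σrel-apply {m} r i α T = begin
  ΣE ⊤ (λ a → ΣE ⊤ (λ b → relCoeff i α a b ⊙ rel N a b)) T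
    ≡⟨ ΣE-⊤ (λ a → ΣE ⊤ (λ b → relCoeff i α a b ⊙ rel N a b)) T ⟩
  sum (λ a → ΣE ⊤ (λ b → relCoeff i α a b ⊙ rel N a b) T)
    ≡⟨ sum-cong-≗ row ⟩
  sum (λ a → α ℚ.* (χ ℚ.* (𝟙 (does (a ∈? T)) ℚ.- ι)))
    ≡⟨ *-distribˡ-sum α (λ a → χ ℚ.* (𝟙 (does (a ∈? T)) ℚ.- ι)) ⟨
  α ℚ.* sum (λ a → χ ℚ.* (𝟙 (does (a ∈? T)) ℚ.- ι))
    ≡⟨ cong (α ℚ.*_) (*-distribˡ-sum χ (λ a → 𝟙 (does (a ∈? T)) ℚ.- ι)) ⟨
  α ℚ.* (χ ℚ.* sum (λ a → 𝟙 (does (a ∈? T)) ℚ.- ι))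
    ≡⟨ cong (λ z → α ℚ.* (χ ℚ.* z)) (sum-𝟙-∈ T ι) ⟩
  α ℚ.* (χ ℚ.* (s ℚ.- ℕ→ℚ m ℚ.* ι)) ∎
  where
  open ≡-Reasoning
  N : RawMatroid m
  N = mkRaw ⊤ r
  χ ι s : ℚ
  χ = x N T T
  ι = 𝟙 (does (i ∈? T))
  s = ℕ→ℚ ∣ T ∣
  row : ∀ a → ΣE ⊤ (λ b → relCoeff i α a b ⊙ rel N a b) T ≡ α ℚ.* (χ ℚ.* (𝟙 (does (a ∈? T)) ℚ.- ι))
  row a = begin
    ΣE ⊤ (λ b → relCoeff i α a b ⊙ rel N a b) T
      ≡⟨ ΣE-⊤ (λ b → relCoeff i α a b ⊙ rel N a b) T ⟩
    sum (λ b → relCoeff i α a b ℚ.* rel N a b T)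
      ≡⟨ sum-single _ i (λ b b≢i → trans (cong (λ d → (if d then α else 0ℚ) ℚ.* rel N a b T)
                                                (dec-false (b Fin.≟ i) b≢i))
                                          (ℚP.*-zeroˡ (rel N a b T))) ⟩
    relCoeff i α a i ℚ.* rel N a i T
      ≡⟨ cong₂ ℚ._*_ (cong (λ d → if d then α else 0ℚ) (dec-true (i Fin.≟ i) refl)) (rel-apply N a i T) ⟩
    α ℚ.* (χ ℚ.* (𝟙 (does (a ∈? T)) ℚ.- ι)) ∎

-- Flats of a deletion

Closed : ∀ {m} → RawMatroid m → Subset m → Set
Closed N F = ∀ e → e ∈ ground N → e ∉ F → rank N F ℕ.< rank N (F ∪ ⁅ e ⁆)

closed-deletion : ∀ {m} {M : RawMatroid m} → IsMatroid M → ∀ {T} i →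
  T ⊆ ground M → Closed M T → Closed (M ∖ i) (T - i)
closed-deletion {m} {M} isM {T} i T⊆E T-closed e e∈E-i e∉T-i = ℕP.≰⇒> X-not-spanned
  where
  open IsMatroid isM
  open ℕP.≤-Reasoning
  r : Subset m → ℕ
  r = rank M
  X : Subset m
  X = (T - i) ∪ ⁅ e ⁆
  e∈E : e ∈ ground M
  e∈E = p─q⊆p _ _ e∈E-i
  e∉T : e ∉ T
  e∉T e∈T = e∉T-i (x∈p∧x≢y⇒x∈p-y e∈T (x∈p-y⇒x≢y e∈E-i))
  X⊆E : X ⊆ ground M
  X⊆E = ∪-lub (T⊆E ∘ p─q⊆p _ _) (λ e′∈⁅e⁆ → subst (_∈ ground M) (sym (x∈⁅y⁆⇒x≡y e e′∈⁅e⁆)) e∈E)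
  T∪e⊆X∪T : T ∪ ⁅ e ⁆ ⊆ X ∪ T
  T∪e⊆X∪T = ∪-lub (q⊆p∪q X T) (p⊆p∪q T ∘ q⊆p∪q (T - i) ⁅ e ⁆)
  T-i⊆X∩T : T - i ⊆ X ∩ T
  T-i⊆X∩T h = x∈p∩q⁺ (p⊆p∪q ⁅ e ⁆ h , p─q⊆p _ _ h)
  X-not-spanned : ¬ (r X ≤ r (T - i))
  X-not-spanned rX≤r[T-i] = ℕP.<⇒≱ (T-closed e e∈E e∉T) (ℕP.+-cancelʳ-≤ (r (T - i)) _ _ (begin
    r (T ∪ ⁅ e ⁆) ℕ.+ r (T - i)
      ≤⟨ ℕP.+-mono-≤ (rank-mono _ _ (∪-lub X⊆E T⊆E) T∪e⊆X∪T) (rank-mono _ _ (T⊆E ∘ p∩q⊆q X T) T-i⊆X∩T) ⟩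
    r (X ∪ T) ℕ.+ r (X ∩ T)
      ≤⟨ rank-submod X T X⊆E T⊆E ⟩
    r X ℕ.+ r T
      ≤⟨ ℕP.+-monoˡ-≤ (r T) rX≤r[T-i] ⟩
    r (T - i) ℕ.+ r T
      ≡⟨ ℕP.+-comm (r (T - i)) (r T) ⟩
    r T ℕ.+ r (T - i) ∎))

deletion-flat⊎trivial : ∀ {m} {M : RawMatroid m} → IsMatroid M → ∀ {T} i → IsNPFlat M T →
  IsNPFlat (M ∖ i) (T - i) ⊎ (T - i ≡ ⊥ ⊎ T - i ≡ ground M - i)
deletion-flat⊎trivial {M = M} isM {T} i (T⊆E , _ , _ , T-closed)
  with nonempty? (T - i) | VecP.≡-dec Bool._≟_ (T - i) (ground M - i)
... | no  T-i≡∅ | _           = inj₂ (inj₁ (Empty-unique T-i≡∅))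
... | yes _     | yes T-i≡E-i = inj₂ (inj₂ T-i≡E-i)
... | yes T-i≢∅ | no  T-i≢E-i =
  inj₁ ( (λ e∈T-i → x∈p∧x≢y⇒x∈p-y (T⊆E (p─q⊆p _ _ e∈T-i)) (x∈p-y⇒x≢y e∈T-i))
       , T-i≢∅ , T-i≢E-i , closed-deletion isM i T⊆E T-closed)

-- The pullback along the deletion

θ-generator : ∀ {m} → RawMatroid m → Fin m → Subset m → Lin m
θ-generator M i F = if does (isNPFlat? (M ∖ i) F) then x M F ⊕ x M (F ∪ ⁅ i ⁆) else 0L

θ-generator-off : ∀ {m} (M : RawMatroid m) i {F T} → F ≢ T - i → θ-generator M i F T ≡ 0ℚ
θ-generator-off M i {F} {T} F≢T-i = by-flatness (isNPFlat? (M ∖ i) F)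
  where
  by-flatness : (F-flat? : Dec (IsNPFlat (M ∖ i) F)) →
    (if does F-flat? then x M F ⊕ x M (F ∪ ⁅ i ⁆) else 0L) T ≡ 0ℚ
  by-flatness (no _)               = refl
  by-flatness (yes (F⊆E-i , _)) =
    trans (cong₂ ℚ._+_ (x-off M (F≢T-i ∘ F≡T⇒F≡T-i)) (x-off M (F≢T-i ∘ F∪i≡T⇒F≡T-i)))
          (ℚP.+-identityˡ 0ℚ)
    where
    i∉F : i ∉ F
    i∉F = x∉p-x (ground M) i ∘ F⊆E-i
    F≡T⇒F≡T-i : F ≡ T → F ≡ T - i
    F≡T⇒F≡T-i F≡T = trans (sym (x∉p⇒p-x≡p i∉F)) (cong (_- i) F≡T)
    F∪i≡T⇒F≡T-i : F ∪ ⁅ i ⁆ ≡ T → F ≡ T - i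
    F∪i≡T⇒F≡T-i F∪i≡T = trans (sym (x∉p⇒p∪⁅x⁆-x≡p i∉F)) (cong (_- i) F∪i≡T)

θ-generator-on : ∀ {m} (M : RawMatroid m) i T → x M (T - i) T ℚ.+ x M ((T - i) ∪ ⁅ i ⁆) T ≡ x M T T
θ-generator-on M i T with i ∈? T
... | yes i∈T = trans (cong₂ ℚ._+_ (x-off M T-i≢T) (cong (λ S → x M S T) (x∈p⇒p-x∪⁅x⁆≡p i∈T)))
                      (ℚP.+-identityˡ (x M T T))
  where
  T-i≢T : T - i ≢ T
  T-i≢T T-i≡T = x∉p-x T i (subst (i ∈_) (sym T-i≡T) i∈T)
... | no  i∉T = trans (cong₂ ℚ._+_ (cong (λ S → x M S T) (x∉p⇒p-x≡p i∉T)) (x-off M T-i∪i≢T))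
                      (ℚP.+-identityʳ (x M T T))
  where
  T-i∪i≢T : (T - i) ∪ ⁅ i ⁆ ≢ T
  T-i∪i≢T eq = i∉T (subst (i ∈_) eq (q⊆p∪q (T - i) ⁅ i ⁆ (x∈⁅x⁆ i)))

θ-apply : ∀ {m} (M : RawMatroid m) i (v : Lin m) T → (∀ F → ¬ IsNPFlat (M ∖ i) F → v F ≡ 0ℚ) →
  θ M i v T ≡ v (T - i) ℚ.* x M T T
θ-apply M i v T v-supported =
  trans (ΣS-single (λ F → v F ⊙ θ-generator M i F) (T - i) T off) (by-flatness (isNPFlat? (M ∖ i) (T - i)))
  where
  off : ∀ F → F ≢ T - i → v F ℚ.* θ-generator M i F T ≡ 0ℚ
  off F F≢T-i = trans (cong (v F ℚ.*_) (θ-generator-off M i F≢T-i)) (ℚP.*-zeroʳ (v F))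
  by-flatness : (T-i-flat? : Dec (IsNPFlat (M ∖ i) (T - i))) →
    v (T - i) ℚ.* (if does T-i-flat? then x M (T - i) ⊕ x M ((T - i) ∪ ⁅ i ⁆) else 0L) T
      ≡ v (T - i) ℚ.* x M T T
  by-flatness (yes _)     = cong (v (T - i) ℚ.*_) (θ-generator-on M i T)
  by-flatness (no ¬flat) rewrite v-supported (T - i) ¬flat =
    trans (ℚP.*-zeroˡ 0ℚ) (sym (ℚP.*-zeroˡ (x M T T)))

θ-γ-apply : ∀ {m} {M : RawMatroid m} → IsMatroid M → ∀ i {u} k T → ∣ ground M - i ∣ ≡ u → k ≤ u →
  θ M i (γ (M ∖ i) k) T ≡ γ-coeff u k ∣ T - i ∣ ℚ.* x M T T
θ-γ-apply {m} {M} isM i k T refl k≤u = begin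
  θ M i (γ (M ∖ i) k) T            ≡⟨ θ-apply M i (γ (M ∖ i) k) T γ-supported ⟩
  γ (M ∖ i) k (T - i) ℚ.* x M T T  ≡⟨ x-coeff-cong M T restricted ⟩
  c ℚ.* x M T T                    ∎
  where
  open ≡-Reasoning
  u : ℕ
  u = ∣ ground M - i ∣
  c : ℚ
  c = γ-coeff u k ∣ T - i ∣
  γ-supported : ∀ F → ¬ IsNPFlat (M ∖ i) F → γ (M ∖ i) k F ≡ 0ℚ
  γ-supported F ¬flat rewrite γ-apply (M ∖ i) k F refl k≤u | x-nonflat (M ∖ i) F ¬flat =
    ℚP.*-zeroʳ (γ-coeff u k ∣ F ∣)
  c*y≡c : ∀ y → c ≡ 0ℚ → c ℚ.* y ≡ c
  c*y≡c y c≡0 = trans (cong (ℚ._* y) c≡0) (trans (ℚP.*-zeroˡ y) (sym c≡0))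
  restricted : IsNPFlat M T → γ (M ∖ i) k (T - i) ≡ c
  restricted T-flat rewrite γ-apply (M ∖ i) k (T - i) refl k≤u with deletion-flat⊎trivial isM i T-flat
  ... | inj₁ T-i-flat       = trans (cong (c ℚ.*_) (x-flat (M ∖ i) T-i-flat)) (ℚP.*-identityʳ c)
  ... | inj₂ (inj₁ T-i≡⊥)   = c*y≡c _ (trans (cong (γ-coeff u k) (trans (cong ∣_∣ T-i≡⊥) (∣⊥∣≡0 m)))
                                              (γ-coeff-empty u k))
  ... | inj₂ (inj₂ T-i≡E-i) = c*y≡c _ (trans (cong (γ-coeff u k ∘ ∣_∣) T-i≡E-i) (γ-coeff-full u k k≤u))

module _ {n : ℕ} (r : Subset (suc (suc n)) → ℕ) (isM : IsMatroid (mkRaw ⊤ r)) (i : Fin (suc (suc n))) where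

  private
    M : RawMatroid (suc (suc n))
    M = mkRaw ⊤ r

  -- The correction term's predicate sees S only through [i ∈ S] and |S|; the two hypotheses
  -- are what the min-terms of the coefficient of x_T need when i ∉ T and when i ∈ T.
  pullback-identity : ∀ K k (d : Bool → ℕ → Bool) → K ≤ suc (suc n) → k ≤ suc n →
    (∀ s → ℕ→ℚ (s ⊓ K) ≡ ℕ→ℚ (s ⊓ k) ℚ.+ 𝟙 (d false s)) →
    (∀ t → ℕ→ℚ (suc t ⊓ K) ℚ.+ ℕ→ℚ k ≡ ℕ→ℚ (t ⊓ k) ℚ.+ 𝟙 (d true (suc t)) ℚ.+ ℕ→ℚ K) →
    γ M K ≈⟨ M ⟩ (θ M i (γ (M ∖ i) k) ⊕ ΣS (λ S → if d (does (i ∈? S)) ∣ S ∣ then x M S else 0L))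
  pullback-identity K k d K≤∣E∣ k≤∣E-i∣ min-step-∉ min-step-∈ = relCoeff i α , pointwise
    where
    α : ℚ
    α = divℕ k (suc n) ℚ.- divℕ K (suc (suc n))
    c : Subset (suc (suc n)) → Bool
    c T = d (does (i ∈? T)) ∣ T ∣
    coefficient : ∀ T →
      γ-coeff (suc (suc n)) K ∣ T ∣ ℚ.- (γ-coeff (suc n) k ∣ T - i ∣ ℚ.+ 𝟙 (c T))
        ≡ α ℚ.* (ℕ→ℚ ∣ T ∣ ℚ.- ℕ→ℚ (suc (suc n)) ℚ.* 𝟙 (does (i ∈? T)))
    coefficient T with i ∈? T
    ... | no  i∉T rewrite x∉p⇒p-x≡p i∉T =
      γ-coeff-deletion-∉ n K k ∣ T ∣ _ (min-step-∉ ∣ T ∣)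
    ... | yes i∈T rewrite sym (x∈p⇒suc∣p-x∣≡∣p∣ i∈T) =
      γ-coeff-deletion-∈ n K k ∣ T - i ∣ _ (min-step-∈ ∣ T - i ∣)
    pointwise : ∀ T → (γ M K ⊖ (θ M i (γ (M ∖ i) k) ⊕ ΣS (λ S → if c S then x M S else 0L))) T
                    ≡ ΣE ⊤ (λ a → ΣE ⊤ (λ b → relCoeff i α a b ⊙ rel M a b)) T
    pointwise T = begin
      γ M K T ℚ.- (θ M i (γ (M ∖ i) k) T ℚ.+ ΣS (λ S → if c S then x M S else 0L) T)
        ≡⟨ cong₂ (λ a b → a ℚ.- b) (γ-apply M K T (∣⊤∣≡n _) K≤∣E∣)
                 (cong₂ ℚ._+_ (θ-γ-apply isM i k T (∣⊤-x∣≡n _ i) k≤∣E-i∣) (ΣS-indicator-apply M c T)) ⟩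
      a ℚ.* χ ℚ.- (b ℚ.* χ ℚ.+ 𝟙 (c T) ℚ.* χ)
        ≡⟨ solve 4 (λ a b e χ → a :* χ :- (b :* χ :+ e :* χ) := (a :- (b :+ e)) :* χ) refl a b (𝟙 (c T)) χ ⟩
      (a ℚ.- (b ℚ.+ 𝟙 (c T))) ℚ.* χ
        ≡⟨ cong (ℚ._* χ) (coefficient T) ⟩
      α ℚ.* (σ ℚ.- ℕ→ℚ (suc (suc n)) ℚ.* ι) ℚ.* χ
        ≡⟨ solve 3 (λ α e χ → α :* e :* χ := α :* (χ :* e)) refl α (σ ℚ.- ℕ→ℚ (suc (suc n)) ℚ.* ι) χ ⟩
      α ℚ.* (χ ℚ.* (σ ℚ.- ℕ→ℚ (suc (suc n)) ℚ.* ι))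
        ≡⟨ Σrel-apply r i α T ⟨
      ΣE ⊤ (λ a → ΣE ⊤ (λ b → relCoeff i α a b ⊙ rel M a b)) T ∎
      where
      open ≡-Reasoning
      open ℚSolver.+-*-Solver
      a b χ σ ι : ℚ
      a = γ-coeff (suc (suc n)) K ∣ T ∣
      b = γ-coeff (suc n) k ∣ T - i ∣
      χ = x M T T
      σ = ℕ→ℚ ∣ T ∣
      ι = 𝟙 (does (i ∈? T))

lemma3p6 : (n : ℕ) (r : Subset (suc n) → ℕ) →
    IsMatroid (mkRaw ⊤ r) → Loopless (mkRaw ⊤ r) →
    (i : Fin (suc n)) (ℓ : ℕ) → 1 ≤ ℓ → ℓ ≤ n →
    (γ (mkRaw ⊤ r) ℓ ≈⟨ mkRaw ⊤ r ⟩
      (θ (mkRaw ⊤ r) i (γ (mkRaw ⊤ r ∖ i) (ℓ ∸ 1))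
        ⊕ ΣS (λ S → if does (¬? (i ∈? S)) ∧ does (ℓ ≤? ∣ S ∣) then x (mkRaw ⊤ r) S else 0L)))
    ×
    (γ (mkRaw ⊤ r) ℓ ≈⟨ mkRaw ⊤ r ⟩
      (θ (mkRaw ⊤ r) i (γ (mkRaw ⊤ r ∖ i) ℓ)
        ⊕ ΣS (λ S → if does (i ∈? S) ∧ does (∣ S ∣ ≤? ℓ) then x (mkRaw ⊤ r) S else 0L)))
lemma3p6 (suc n) r isM _ i (suc k) _ (ℕ.s≤s k≤n) =
    pullback-identity r isM i (suc k) k (λ i∈S s → not i∈S ∧ does (suc k ≤? s))
      (ℕ.s≤s k≤n+1) k≤n+1 (λ s → ℕ→ℚ-⊓-suc s k) shifted-min-step
  , pullback-identity r isM i (suc k) (suc k) (λ i∈S s → i∈S ∧ does (s ≤? suc k))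
      (ℕP.m≤n⇒m≤1+n (ℕ.s≤s k≤n)) (ℕ.s≤s k≤n) (λ s → sym (ℚP.+-identityʳ (ℕ→ℚ (s ⊓ suc k))))
      (λ t → cong (ℚ._+ ℕ→ℚ (suc k)) (ℕ→ℚ-suc-⊓ t (suc k)))
  where
  open ≡-Reasoning
  open ℚSolver.+-*-Solver
  k≤n+1 : k ≤ suc n
  k≤n+1 = ℕP.m≤n⇒m≤1+n k≤n
  shifted-min-step : ∀ t → ℕ→ℚ (suc (t ⊓ k)) ℚ.+ ℕ→ℚ k ≡ ℕ→ℚ (t ⊓ k) ℚ.+ 0ℚ ℚ.+ ℕ→ℚ (suc k)
  shifted-min-step t = begin
    ℕ→ℚ (suc (t ⊓ k)) ℚ.+ ℕ→ℚ k         ≡⟨ cong (ℚ._+ ℕ→ℚ k) (ℕ→ℚ-suc (t ⊓ k)) ⟩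
    (1ℚ ℚ.+ ℕ→ℚ (t ⊓ k)) ℚ.+ ℕ→ℚ k      ≡⟨ solve 2 (λ q k → (con 1ℚ :+ q) :+ k := q :+ con 0ℚ :+ (con 1ℚ :+ k))
                                                   refl (ℕ→ℚ (t ⊓ k)) (ℕ→ℚ k) ⟩
    ℕ→ℚ (t ⊓ k) ℚ.+ 0ℚ ℚ.+ (1ℚ ℚ.+ ℕ→ℚ k) ≡⟨ cong (ℕ→ℚ (t ⊓ k) ℚ.+ 0ℚ ℚ.+_) (ℕ→ℚ-suc k) ⟨
    ℕ→ℚ (t ⊓ k) ℚ.+ 0ℚ ℚ.+ ℕ→ℚ (suc k)   ∎
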